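{- There is a function $g(d)=O(\log^2 d\,\log\log d)$ such that for every integer $n$ and all $d=d(n)$, $d'=d'(n)$ with $d\le n/2$ and $g(d)<d'\le d-1$: (i) $\mathsf{NOBDD^{\lfloor\log d\rfloor}}\subsetneq\mathsf{OBDD^{d}}$; and (ii) $\mathsf{OBDD^{d}}$ and $\mathsf{NOBDD^{d'}}$ are incomparable, i.e. neither is contained in the other.
   Context: $\log$ is base $2$. $\mathsf{OBDD^d}$ (resp. $\mathsf{NOBDD^d}$) denotes the set of Boolean functions $f:\{0,1\}^n\to\{0,1\}$ computable by a deterministic (resp. nondeterministic) OBDD of width $d$ (at most $d$ nodes per level), $n$ being the number of variables. A deterministic OBDD on $x_1,\dots,x_n$ with order $\pi$ (a permutation of $\{1,\dots,n\}$) is a leveled directed acyclic graph with levels $0,\dots,n$, a single source at level $0$, every node at level $j-1$ having exactly one outgoing edge labelled $0$ and one labelled $1$ to nodes at level $j$, and nodes at level $n$ marked accepting or rejecting; on input $\nu$ one follows from the source at step $j$ the edge labelled $\nu_{\pi(j)}$ and outputs $1$ iff an accepting node is reached. A nondeterministic OBDD allows any number of outgoing edges with each label and outputs $1$ iff some consistent path reaches an accepting node. Width is the maximum number of nodes in a level. -}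

module Defs where

open import Data.Nat using (ℕ; zero; suc; _*_; _≤_)
open import Data.Nat.Logarithm using (⌊log₂_⌋)
open import Data.Bool using (Bool; true; false)
open import Data.Fin using (Fin; zero; suc; inject₁; fromℕ)
open import Data.Fin.Permutation using (Permutation′; _⟨$⟩ʳ_)
open import Data.List using (foldl; allFin)
open import Data.Product using (Σ; _×_; ∃)
open import Relation.Binary.PropositionalEquality using (_≡_)
open import Relation.Nullary using (¬_)
open import Function.Bundles using (_⇔_)

BoolFun : ℕ → Set
BoolFun n = (Fin n → Bool) → Bool

-- Every level 0..n has node set Fin d (padding with unreachable nodes is
-- harmless; a level with fewer nodes is simulated by leaving nodes unused).
-- Step j+1 (j : Fin n) reads variable x_{π(j)} and moves from level j to j+1
-- along the edge 'trans j node bit'.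
record OBDD (n d : ℕ) : Set where
  field
    order  : Permutation′ n
    source : Fin d
    trans  : Fin n → Fin d → Bool → Fin d
    accept : Fin d → Bool

evalOBDD : ∀ {n d} → OBDD n d → BoolFun n
evalOBDD {n} B x =
  accept (foldl (λ s j → trans j s (x (order ⟨$⟩ʳ j))) source (allFin n))
  where open OBDD B

-- A nondeterministic OBDD of width (at most) d on n variables:
-- 'edge j u b v ≡ true' means there is an edge labelled b from node u at
-- level j to node v at level j+1.
record NOBDD (n d : ℕ) : Set where
  field
    order  : Permutation′ n
    source : Fin d
    edge   : Fin n → Fin d → Bool → Fin d → Bool
    accept : Fin d → Bool

AcceptingPath : ∀ {n d} → NOBDD n d → (Fin n → Bool) → (Fin (suc n) → Fin d) → Set
AcceptingPath {n} B x p =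
  (p zero ≡ source)
  × ((j : Fin n) → edge j (p (inject₁ j)) (x (order ⟨$⟩ʳ j)) (p (suc j)) ≡ true)
  × (accept (p (fromℕ n)) ≡ true)
  where open NOBDD B

NAccepts : ∀ {n d} → NOBDD n d → (Fin n → Bool) → Set
NAccepts {n} {d} B x = ∃ λ (p : Fin (suc n) → Fin d) → AcceptingPath B x p

InOBDD : (n d : ℕ) → BoolFun n → Set
InOBDD n d f = Σ (OBDD n d) λ B → ∀ x → evalOBDD B x ≡ f x

InNOBDD : (n d : ℕ) → BoolFun n → Set
InNOBDD n d f = Σ (NOBDD n d) λ B → ∀ x → (f x ≡ true) ⇔ NAccepts B x

_⊆ᶜ_ : ∀ {n} → (BoolFun n → Set) → (BoolFun n → Set) → Set
C ⊆ᶜ D = ∀ f → C f → D f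

_⊊ᶜ_ : ∀ {n} → (BoolFun n → Set) → (BoolFun n → Set) → Set
C ⊊ᶜ D = (C ⊆ᶜ D) × (∃ λ f → D f × ¬ C f)

Incomparable : ∀ {n} → (BoolFun n → Set) → (BoolFun n → Set) → Set
Incomparable C D = (∃ λ f → C f × ¬ D f) × (∃ λ f → D f × ¬ C f)

IsBigOLog2LogLog : (ℕ → ℕ) → Set
IsBigOLog2LogLog g =
  ∃ λ C → ∃ λ N → ∀ d → N ≤ d →
    g d ≤ C * (⌊log₂ d ⌋ * ⌊log₂ d ⌋ * ⌊log₂ ⌊log₂ d ⌋ ⌋)

-- The inclusion is the subset construction: a nondeterministic OBDD of width ⌊log d⌋
-- becomes a deterministic one of width 2^⌊log d⌋ ≤ d. Both separations use symmetric
-- functions, for which the inputs 1^i 0^(k-i) | 1^(k-j) 0^(n-2k+j) form a fooling set: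
-- if the accepting paths for two of them met at level k, the crossed input would be
-- accepted too. The threshold function [weight ≥ d - 1] is a counter of width d but
-- needs width d even nondeterministically. The function "weight ≢ d modulo some
-- j ≤ N", N = 2⌊log d⌋ + 3, is the union of N modular counters, so it has an NOBDD of
-- width N² = g(d); a deterministic one needs width > d, because a + (d - b) ≡ d modulo
-- every j ≤ N makes b - a a common multiple of 1, …, N, which is ≥ 2^((N-1)/2) > d
-- (Nair's bound via Leibniz's harmonic triangle).
module Submission where

open import Defs
open import Data.Nat using (ℕ; _*_; _≤_; _<_; _∸_)
open import Data.Nat.Logarithm using (⌊log₂_⌋)
open import Data.Product using (Σ; _×_)

open import Data.Bool using (Bool; true; false; _∧_; if_then_else_)
import Data.Bool.Properties as Bool
open import Data.Empty using (⊥-elim)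
open import Data.Fin
  using (Fin; zero; suc; toℕ; fromℕ; fromℕ<; inject₁; inject≤; _↑ˡ_; _↑ʳ_; combine; remQuot; funToFin; finToFun; _≟_)
open import Data.Fin.Properties
  using (toℕ<n; toℕ-fromℕ<; toℕ-inject≤; toℕ-injective; any?; pigeonhole; 2↔Bool; finToFun-funToFin; remQuot-combine)
import Data.Fin.Permutation as Perm
open import Data.Fin.Permutation using (Permutation′; _⟨$⟩ʳ_; _⟨$⟩ˡ_; inverseˡ)
open import Data.List using (_∷_; []; foldl; tabulate)
open import Data.Nat
  using (zero; suc; _+_; _^_; _%_; _/_; _⊓_; _!; _<ᵇ_; z≤n; s≤s; s≤s⁻¹; NonZero; >-nonZero; ⌊_/2⌋)
import Data.Nat as ℕ using (_≟_)
open import Data.Nat.Divisibility using (_∣_; divides; ∣⇒≤; ∣m+n∣m⇒∣n; m∣m*n)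
open import Data.Nat.DivMod using (m≡m%n+[m/n]*n; m%n<n; m<n⇒m%n≡m; %-distribˡ-+; m%n%n≡m%n)
open import Data.Nat.GeneralisedArithmetic using (iterate)
open import Data.Nat.Logarithm using (⌊log₂⌋-mono-≤)
open import Data.Nat.Logarithm.Core using (⌊log2⌋)
open import Data.Nat.Properties hiding (_≟_)
open import Data.Nat.Tactic.RingSolver using (solve-∀; solve)
open import Data.Product using (∃; _,_; proj₁; proj₂; uncurry)
open import Data.Vec.Functional using (_++_)
open import Data.Vec.Functional.Properties using (lookup-++ˡ; lookup-++ʳ)
open import Algebra.Properties.CommutativeMonoid.Sum +-0-commutativeMonoid using (sum; sum-permute; sum-cong-≗)
open import Algebra.Properties.CommutativeSemigroup *-commutativeSemigroup using (x∙yz≈y∙xz)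
open import Function using (_∘_; _⇔_; mk⇔; Equivalence; Inverse; case_of_)
open import Function.Construct.Composition using (_⇔-∘_)
import Induction.WellFounded as WF
open import Relation.Binary.PropositionalEquality
open import Relation.Nullary using (¬_; Dec; yes; no; does; contradiction)
open import Relation.Nullary.Decidable using (dec-true; dec-false; ¬?; does-⇔; decidable-stable)

variable
  A : Set
  n w : ℕ

n<2^n : ∀ n → n < 2 ^ n
n<2^n zero    = s≤s z≤n
n<2^n (suc n) = +-mono-≤ (≤-trans (s≤s z≤n) (n<2^n n)) (≤-trans (n<2^n n) (m≤m+n _ 0))

⌊n/2⌋+⌊n/2⌋≤n : ∀ n → ⌊ n /2⌋ + ⌊ n /2⌋ ≤ n
⌊n/2⌋+⌊n/2⌋≤n zero          = z≤n
⌊n/2⌋+⌊n/2⌋≤n (suc zero)    = z≤n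
⌊n/2⌋+⌊n/2⌋≤n (suc (suc n)) rewrite +-suc ⌊ n /2⌋ ⌊ n /2⌋ = s≤s (s≤s (⌊n/2⌋+⌊n/2⌋≤n n))

n≤1+⌊n/2⌋+⌊n/2⌋ : ∀ n → n ≤ suc (⌊ n /2⌋ + ⌊ n /2⌋)
n≤1+⌊n/2⌋+⌊n/2⌋ zero          = z≤n
n≤1+⌊n/2⌋+⌊n/2⌋ (suc zero)    = s≤s z≤n
n≤1+⌊n/2⌋+⌊n/2⌋ (suc (suc n)) rewrite +-suc ⌊ n /2⌋ ⌊ n /2⌋ = s≤s (s≤s (n≤1+⌊n/2⌋+⌊n/2⌋ n))

2*[1+m]≡2+[m+m] : ∀ m → 2 * suc m ≡ 2 + (m + m)
2*[1+m]≡2+[m+m] = solve-∀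

2*[2+m]≡4+[m+m] : ∀ m → 2 * (2 + m) ≡ 4 + (m + m)
2*[2+m]≡4+[m+m] = solve-∀

⌊log2⌋-bounds : ∀ n (rec : WF.Acc _<_ n) → .{{NonZero n}} →
                2 ^ ⌊log2⌋ n rec ≤ n × n < 2 ^ suc (⌊log2⌋ n rec)
⌊log2⌋-bounds 1             _        = ≤-refl , s≤s (s≤s z≤n)
⌊log2⌋-bounds (suc (suc n)) (WF.acc rs) with ⌊log2⌋-bounds (suc ⌊ n /2⌋) (rs (⌊n/2⌋<n (suc n)))
... | lower , upper = lower′ , upper′
  where
  open ≤-Reasoning
  h : ℕ
  h = ⌊ n /2⌋
  L : ℕ
  L = ⌊log2⌋ (suc h) (rs (⌊n/2⌋<n (suc n)))
  lower′ : 2 * 2 ^ L ≤ 2 + n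
  lower′ = begin
    2 * 2 ^ L          ≤⟨ *-monoʳ-≤ 2 lower ⟩
    2 * suc h          ≡⟨ 2*[1+m]≡2+[m+m] h ⟩
    2 + (h + h)        ≤⟨ +-monoʳ-≤ 2 (⌊n/2⌋+⌊n/2⌋≤n n) ⟩
    2 + n              ∎
  upper′ : 3 + n ≤ 2 * 2 ^ suc L
  upper′ = begin
    3 + n              ≤⟨ +-monoʳ-≤ 3 (n≤1+⌊n/2⌋+⌊n/2⌋ n) ⟩
    4 + (h + h)        ≡⟨ 2*[2+m]≡4+[m+m] h ⟨
    2 * suc (suc h)    ≤⟨ *-monoʳ-≤ 2 upper ⟩
    2 * 2 ^ suc L      ∎

2^⌊log₂n⌋≤n : ∀ n → .{{NonZero n}} → 2 ^ ⌊log₂ n ⌋ ≤ n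
2^⌊log₂n⌋≤n n = proj₁ (⌊log2⌋-bounds n _)

n<2^[1+⌊log₂n⌋] : ∀ n → .{{NonZero n}} → n < 2 ^ suc ⌊log₂ n ⌋
n<2^[1+⌊log₂n⌋] n = proj₂ (⌊log2⌋-bounds n _)

-- binom k r is the binomial coefficient (k + r choose k).
binom : ℕ → ℕ → ℕ
binom zero    r       = 1
binom (suc k) zero    = 1
binom (suc k) (suc r) = binom k (suc r) + binom (suc k) r

binom-comm : ∀ k r → binom k r ≡ binom r k
binom-comm zero    zero    = refl
binom-comm zero    (suc r) = refl
binom-comm (suc k) zero    = refl
binom-comm (suc k) (suc r) =
  trans (cong₂ _+_ (binom-comm k (suc r)) (binom-comm (suc k) r))
        (+-comm (binom (suc r) k) (binom r (suc k)))

binom*k!*r!≡[k+r]! : ∀ k r → binom k r * (k ! * r !) ≡ (k + r) !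
binom*k!*r!≡[k+r]! zero    r    = trans (+-identityʳ _) (*-identityˡ (r !))
binom*k!*r!≡[k+r]! (suc k) zero = trans (*-identityˡ _) (trans (*-identityʳ _) (cong _! (sym (+-identityʳ (suc k)))))
binom*k!*r!≡[k+r]! (suc k) (suc r) = begin
  (binom k (suc r) + binom (suc k) r) * (suc k ! * suc r !)
    ≡⟨ regroup (binom k (suc r)) (binom (suc k) r) k r (k !) (r !) ⟩
  suc k * (binom k (suc r) * (k ! * suc r !)) + suc r * (binom (suc k) r * (suc k ! * r !))
    ≡⟨ cong₂ (λ u v → suc k * u + suc r * v) (binom*k!*r!≡[k+r]! k (suc r)) (binom*k!*r!≡[k+r]! (suc k) r) ⟩
  suc k * (k + suc r) ! + suc r * (suc k + r) !
    ≡⟨ cong (λ t → suc k * (k + suc r) ! + suc r * t !) (sym (+-suc k r)) ⟩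
  suc k * (k + suc r) ! + suc r * (k + suc r) !
    ≡⟨ *-distribʳ-+ ((k + suc r) !) (suc k) (suc r) ⟨
  (suc k + suc r) * (k + suc r) !
    ∎
  where
  open ≡-Reasoning
  regroup : ∀ a b k r f g → (a + b) * ((suc k * f) * (suc r * g)) ≡
            suc k * (a * (f * (suc r * g))) + suc r * (b * ((suc k * f) * g))
  regroup = solve-∀

binom-absorbˡ : ∀ k r → suc k * binom (suc k) r ≡ suc (k + r) * binom k r
binom-absorbˡ k r = *-cancelʳ-≡ _ _ (k ! * r !) {{k !* r !≢0}} (begin
  suc k * binom (suc k) r * (k ! * r !)    ≡⟨ regroup k (binom (suc k) r) (k !) (r !) ⟩
  binom (suc k) r * (suc k ! * r !)        ≡⟨ binom*k!*r!≡[k+r]! (suc k) r ⟩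
  suc (k + r) !                            ≡⟨ cong (suc (k + r) *_) (binom*k!*r!≡[k+r]! k r) ⟨
  suc (k + r) * (binom k r * (k ! * r !))  ≡⟨ *-assoc (suc (k + r)) (binom k r) _ ⟨
  suc (k + r) * binom k r * (k ! * r !)    ∎)
  where
  open ≡-Reasoning
  regroup : ∀ k b f g → suc k * b * (f * g) ≡ b * ((suc k * f) * g)
  regroup = solve-∀

binom-absorbʳ : ∀ k r → suc r * binom k (suc r) ≡ suc (k + r) * binom k r
binom-absorbʳ k r = begin
  suc r * binom k (suc r)  ≡⟨ cong (suc r *_) (binom-comm k (suc r)) ⟩
  suc r * binom (suc r) k  ≡⟨ binom-absorbˡ r k ⟩
  suc (r + k) * binom r k  ≡⟨ cong₂ (λ s t → suc s * t) (+-comm r k) (binom-comm r k) ⟩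
  suc (k + r) * binom k r  ∎
  where open ≡-Reasoning

binom-monoʳ : ∀ k r → binom k r ≤ binom k (suc r)
binom-monoʳ zero    r = ≤-refl
binom-monoʳ (suc k) r = m≤n+m (binom (suc k) r) (binom k (suc r))

2^n≤binom[n,n] : ∀ n → 2 ^ n ≤ binom n n
2^n≤binom[n,n] zero    = ≤-refl
2^n≤binom[n,n] (suc n) = begin
  2 ^ n + (2 ^ n + 0)            ≡⟨ cong (2 ^ n +_) (+-identityʳ (2 ^ n)) ⟩
  2 ^ n + 2 ^ n                  ≤⟨ +-mono-≤ (2^n≤binom[n,n] n) (2^n≤binom[n,n] n) ⟩
  binom n n + binom n n          ≤⟨ +-mono-≤ (binom-monoʳ n n) (binom-monoʳ n n) ⟩
  binom n (suc n) + binom n (suc n) ≡⟨ cong (binom n (suc n) +_) (binom-comm n (suc n)) ⟩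
  binom n (suc n) + binom (suc n) n ∎
  where open ≤-Reasoning

-- The hypotheses say 1/a = 1/b + 1/c, so δ/c = δ/a - δ/b is an integer.
∣-harmonic : ∀ p q {a b c δ} → suc p * c ≡ (suc p + suc q) * a → suc q * b ≡ (suc p + suc q) * a →
             a ∣ δ → b ∣ δ → c ∣ δ
∣-harmonic p q {a} {b} {c} (pc≡γa) (qb≡γa) (divides x refl) (divides y xa≡yb) =
  ∣m+n∣m⇒∣n (divides x (*-cancelˡ-≡ _ _ (suc p) key)) (m∣m*n y)
  where
  open ≡-Reasoning
  key : suc p * (c * y + x * a) ≡ suc p * (x * c)
  key = begin
    suc p * (c * y + x * a)             ≡⟨ solve (p ∷ c ∷ y ∷ x ∷ a ∷ []) ⟩
    suc p * (x * a) + y * (suc p * c)   ≡⟨ cong (λ t → suc p * (x * a) + y * t) (trans pc≡γa (sym qb≡γa)) ⟩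
    suc p * (x * a) + y * (suc q * b)   ≡⟨ solve (p ∷ x ∷ a ∷ y ∷ q ∷ b ∷ []) ⟩
    suc p * (x * a) + suc q * (y * b)   ≡⟨ cong (λ t → suc p * (x * a) + suc q * t) xa≡yb ⟨
    suc p * (x * a) + suc q * (x * a)   ≡⟨ solve (p ∷ x ∷ a ∷ q ∷ []) ⟩
    (suc p + suc q) * a * x             ≡⟨ cong (_* x) pc≡γa ⟨
    suc p * c * x                       ≡⟨ solve (p ∷ c ∷ x ∷ []) ⟩
    suc p * (x * c)                     ∎

-- The reciprocals of the entries of Leibniz's harmonic triangle; they satisfy
-- 1/leibniz k r = 1/leibniz (1 + k) r + 1/leibniz k (1 + r).
leibniz : ℕ → ℕ → ℕ
leibniz k r = suc (k + r) * binom k r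

leibniz-∣ : ∀ {N δ} → (∀ j → j < N → suc j ∣ δ) → ∀ k r → k + r < N → leibniz k r ∣ δ
leibniz-∣ {δ = δ} divisors zero    r r<N = subst (_∣ δ) (sym (*-identityʳ (suc r))) (divisors r r<N)
leibniz-∣ {N} divisors (suc k) r k+r<N =
  ∣-harmonic k r absorbˡ absorbʳ
    (leibniz-∣ divisors k r (<-trans (n<1+n _) k+r<N))
    (leibniz-∣ divisors k (suc r) (subst (_< N) (sym (+-suc k r)) k+r<N))
  where
  open ≡-Reasoning
  absorbˡ : suc k * leibniz (suc k) r ≡ (suc k + suc r) * leibniz k r
  absorbˡ = begin
    suc k * (suc (suc k + r) * binom (suc k) r)   ≡⟨ x∙yz≈y∙xz (suc k) (suc (suc k + r)) (binom (suc k) r) ⟩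
    suc (suc k + r) * (suc k * binom (suc k) r)   ≡⟨ cong₂ _*_ (cong suc (sym (+-suc k r))) (binom-absorbˡ k r) ⟩
    (suc k + suc r) * leibniz k r                 ∎
  absorbʳ : suc r * leibniz k (suc r) ≡ (suc k + suc r) * leibniz k r
  absorbʳ = begin
    suc r * (suc (k + suc r) * binom k (suc r))   ≡⟨ x∙yz≈y∙xz (suc r) (suc (k + suc r)) (binom k (suc r)) ⟩
    suc (k + suc r) * (suc r * binom k (suc r))   ≡⟨ cong (suc (k + suc r) *_) (binom-absorbʳ k r) ⟩
    (suc k + suc r) * leibniz k r                 ∎

2^m≤common-multiple : ∀ m {δ} .{{_ : NonZero δ}} → (∀ j → j < suc (m + m) → suc j ∣ δ) → 2 ^ m ≤ δ
2^m≤common-multiple m {δ} divisors = begin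
  2 ^ m                   ≤⟨ 2^n≤binom[n,n] m ⟩
  binom m m               ≤⟨ m≤n*m (binom m m) (suc (m + m)) ⟩
  leibniz m m             ≤⟨ ∣⇒≤ (leibniz-∣ divisors m m ≤-refl) ⟩
  δ                       ∎
  where open ≤-Reasoning

m%n≡[m+o]%n⇒n∣o : ∀ m n o .{{_ : NonZero n}} → m % n ≡ (m + o) % n → n ∣ o
m%n≡[m+o]%n⇒n∣o m n o eq = divides ((m + o) / n ∸ m / n) (begin
  o                                              ≡⟨ m+n∸m≡n m o ⟨
  (m + o) ∸ m                                    ≡⟨ cong₂ _∸_ (m≡m%n+[m/n]*n (m + o) n) (m≡m%n+[m/n]*n m n) ⟩
  ((m + o) % n + (m + o) / n * n) ∸ (m % n + m / n * n)
    ≡⟨ cong (λ r → ((m + o) % n + (m + o) / n * n) ∸ (r + m / n * n)) eq ⟩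
  ((m + o) % n + (m + o) / n * n) ∸ ((m + o) % n + m / n * n)
    ≡⟨ [m+n]∸[m+o]≡n∸o ((m + o) % n) _ _ ⟩
  (m + o) / n * n ∸ m / n * n                    ≡⟨ *-distribʳ-∸ n ((m + o) / n) (m / n) ⟨
  ((m + o) / n ∸ m / n) * n                      ∎)
  where open ≡-Reasoning

m<n≤o⇒m+[o∸n]<o : ∀ {m n o} → m < n → n ≤ o → m + (o ∸ n) < o
m<n≤o⇒m+[o∸n]<o {m} {n} {o} m<n n≤o = begin-strict
  m + (o ∸ n)   <⟨ +-monoˡ-< (o ∸ n) m<n ⟩
  n + (o ∸ n)   ≡⟨ m+[n∸m]≡n n≤o ⟩
  o             ∎
  where open ≤-Reasoning

m+[o∸n]+[n∸m]≡o : ∀ {m n o} → m ≤ n → n ≤ o → m + (o ∸ n) + (n ∸ m) ≡ o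
m+[o∸n]+[n∸m]≡o {m} {n} {o} m≤n n≤o = begin
  m + (o ∸ n) + (n ∸ m)    ≡⟨ +-assoc m (o ∸ n) (n ∸ m) ⟩
  m + ((o ∸ n) + (n ∸ m))  ≡⟨ cong (m +_) (+-comm (o ∸ n) (n ∸ m)) ⟩
  m + ((n ∸ m) + (o ∸ n))  ≡⟨ +-assoc m (n ∸ m) (o ∸ n) ⟨
  m + (n ∸ m) + (o ∸ n)    ≡⟨ cong (_+ (o ∸ n)) (m+[n∸m]≡n m≤n) ⟩
  n + (o ∸ n)              ≡⟨ m+[n∸m]≡n n≤o ⟩
  o                        ∎
  where open ≡-Reasoning

[m⊓o+n]⊓o≡[m+n]⊓o : ∀ m n o → (m ⊓ o + n) ⊓ o ≡ (m + n) ⊓ o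
[m⊓o+n]⊓o≡[m+n]⊓o m n o = begin
  (m ⊓ o + n) ⊓ o            ≡⟨ cong (_⊓ o) (+-distribʳ-⊓ n m o) ⟩
  ((m + n) ⊓ (o + n)) ⊓ o    ≡⟨ ⊓-assoc (m + n) (o + n) o ⟩
  (m + n) ⊓ ((o + n) ⊓ o)    ≡⟨ cong ((m + n) ⊓_) (m≥n⇒m⊓n≡n (m≤m+n o n)) ⟩
  (m + n) ⊓ o                ∎
  where open ≡-Reasoning

[m%n+o]%n≡[m+o]%n : ∀ m n o .{{_ : NonZero n}} → (m % n + o) % n ≡ (m + o) % n
[m%n+o]%n≡[m+o]%n m n o = begin
  (m % n + o) % n             ≡⟨ %-distribˡ-+ (m % n) o n ⟩
  (m % n % n + o % n) % n     ≡⟨ cong (λ t → (t + o % n) % n) (m%n%n≡m%n m n) ⟩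
  (m % n + o % n) % n         ≡⟨ %-distribˡ-+ m o n ⟨
  (m + o) % n                 ∎
  where open ≡-Reasoning

n*2≡n+n : ∀ n → n * 2 ≡ n + n
n*2≡n+n = solve-∀

-- Walks through layered relations

run : (Fin n → A → A) → A → A
run {n = zero}  H s = s
run {n = suc n} H s = run (H ∘ suc) (H zero s)

foldl-tabulate : ∀ {B : Set} {n} (f : A → B → A) (t : Fin n → B) s →
                 foldl f s (tabulate t) ≡ run (λ j s → f s (t j)) s
foldl-tabulate {n = zero}  f t s = refl
foldl-tabulate {n = suc n} f t s = foldl-tabulate f (t ∘ suc) (f s (t zero))

run-natural : ∀ {B : Set} (f : A → B) {H : Fin n → A → A} {H′ : Fin n → B → B} →
              (∀ j s → f (H j s) ≡ H′ j (f s)) → ∀ s → f (run H s) ≡ run H′ (f s)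
run-natural {n = zero}  f commutes s = refl
run-natural {n = suc n} f {H} {H′} commutes s =
  trans (run-natural f (commutes ∘ suc) (H zero s)) (cong (run (H′ ∘ suc)) (commutes zero s))

Reach : (Fin n → A → A → Set) → A → A → Set
Reach {n = zero}  R s t = s ≡ t
Reach {n = suc n} R s t = ∃ λ u → R zero s u × Reach (R ∘ suc) u t

Reach-map : ∀ {R R′ : Fin n → A → A → Set} → (∀ j {u v} → R j u v → R′ j u v) →
            ∀ {s t} → Reach R s t → Reach R′ s t
Reach-map {n = zero}  f s≡t           = s≡t
Reach-map {n = suc n} f (u , r , rest) = u , f zero r , Reach-map (f ∘ suc) rest

Reach-split : ∀ k {m} (R : Fin (k + m) → A → A → Set) {s t} → Reach R s t →
              ∃ λ u → Reach (R ∘ (_↑ˡ m)) s u × Reach (R ∘ (k ↑ʳ_)) u t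
Reach-split zero    R reach          = _ , refl , reach
Reach-split (suc k) R (u , r , rest) with Reach-split k (R ∘ suc) rest
... | v , front , back = v , (u , r , front) , back

Reach-join : ∀ k {m} (R : Fin (k + m) → A → A → Set) {s u t} →
             Reach (R ∘ (_↑ˡ m)) s u → Reach (R ∘ (k ↑ʳ_)) u t → Reach R s t
Reach-join zero    R refl              back = back
Reach-join (suc k) R (v , r , front) back = v , r , Reach-join k (R ∘ suc) front back

Path : (Fin n → A → A → Set) → A → A → Set
Path {n = n} {A = A} R s t = ∃ λ (p : Fin (suc n) → A) →
  p zero ≡ s × (∀ j → R j (p (inject₁ j)) (p (suc j))) × p (fromℕ n) ≡ t

Reach⇔Path : ∀ (R : Fin n → A → A → Set) {s t} → Reach R s t ⇔ Path R s t
Reach⇔Path R = mk⇔ (to R) (from R)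
  where
  to : ∀ {n} (R : Fin n → A → A → Set) {s t} → Reach R s t → Path R s t
  to {n = zero}  R {s} s≡t = (λ _ → s) , refl , (λ ()) , s≡t
  to {n = suc n} R {s} (u , r , rest) with to (R ∘ suc) rest
  ... | p , refl , steps , end = walk , refl , walk-steps , end
    where
    walk : Fin (suc (suc n)) → _
    walk zero    = s
    walk (suc j) = p j
    walk-steps : ∀ j → R j (walk (inject₁ j)) (walk (suc j))
    walk-steps zero    = r
    walk-steps (suc j) = steps j
  from : ∀ {n} (R : Fin n → A → A → Set) {s t} → Path R s t → Reach R s t
  from {n = zero}  R (p , refl , _ , end) = end
  from {n = suc n} R (p , refl , steps , end) =
    p (suc zero) , steps zero , from (R ∘ suc) (p ∘ suc , refl , steps ∘ suc , end)

Reach-graph : ∀ (H : Fin n → A → A) {s t} → Reach (λ j u v → v ≡ H j u) s t ⇔ t ≡ run H s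
Reach-graph H = mk⇔ (to H) (from H)
  where
  to : ∀ {n} (H : Fin n → A → A) {s t} → Reach (λ j u v → v ≡ H j u) s t → t ≡ run H s
  to {n = zero}  H refl              = refl
  to {n = suc n} H (_ , refl , rest) = to (H ∘ suc) rest
  from : ∀ {n} (H : Fin n → A → A) {s t} → t ≡ run H s → Reach (λ j u v → v ≡ H j u) s t
  from {n = zero}  H refl = refl
  from {n = suc n} H t≡  = _ , refl , from (H ∘ suc) t≡

does⇔ : ∀ {P : Set} (d : Dec P) → does d ≡ true ⇔ P
does⇔ (yes p) = mk⇔ (λ _ → p) (λ _ → refl)
does⇔ (no ¬p) = mk⇔ (λ ()) (λ p → contradiction p ¬p)

∧⇔× : ∀ {a b} → a ∧ b ≡ true ⇔ (a ≡ true × b ≡ true)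
∧⇔× {true}  = mk⇔ (refl ,_) proj₂
∧⇔× {false} = mk⇔ (λ ()) (λ ())

anyᵇ : ∀ {m} → (Fin m → Bool) → Bool
anyᵇ f = does (any? (λ i → f i Bool.≟ true))

anyᵇ⇔ : ∀ {m} (f : Fin m → Bool) → anyᵇ f ≡ true ⇔ ∃ λ i → f i ≡ true
anyᵇ⇔ f = does⇔ (any? _)

weight : (Fin n → Bool) → ℕ
weight x = sum (λ i → if x i then 1 else 0)

weight-cong : ∀ {x y : Fin n → Bool} → (∀ i → x i ≡ y i) → weight x ≡ weight y
weight-cong x≗y = sum-cong-≗ (λ i → cong (if_then 1 else 0) (x≗y i))

weight-permute : ∀ (π : Permutation′ n) x → weight (x ∘ (π ⟨$⟩ʳ_)) ≡ weight x
weight-permute π x = sym (sum-permute _ π)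

sum-↑ : ∀ {k m} (f : Fin (k + m) → ℕ) → sum f ≡ sum (f ∘ (_↑ˡ m)) + sum (f ∘ (k ↑ʳ_))
sum-↑ {zero}      f = refl
sum-↑ {suc k} {m} f = trans (cong (f zero +_) (sum-↑ {k} {m} (f ∘ suc))) (sym (+-assoc (f zero) _ _))

weight-++ : ∀ {k m} (a : Fin k → Bool) (b : Fin m → Bool) → weight (a ++ b) ≡ weight a + weight b
weight-++ {k} {m} a b = trans (sum-↑ {k} {m} (λ i → if (a ++ b) i then 1 else 0))
  (cong₂ _+_ (weight-cong {x = (a ++ b) ∘ (_↑ˡ m)} (lookup-++ˡ a b))
             (weight-cong {x = (a ++ b) ∘ (k ↑ʳ_)} (lookup-++ʳ a b)))

ones : ℕ → Fin n → Bool
ones c i = toℕ i <ᵇ c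

weight-ones : ∀ c → c ≤ n → weight (ones {n} c) ≡ c
weight-ones {zero}  zero    _         = refl
weight-ones {suc n} zero    _         = weight-ones {n} zero z≤n
weight-ones {suc n} (suc c) (s≤s c≤n) = cong suc (weight-ones c c≤n)

-- Semantics in reading order: diagrams are analysed on the input listed in the order
-- in which they read it, y j = x (order ⟨$⟩ʳ j).

evalInOrder : OBDD n w → (Fin n → Bool) → Bool
evalInOrder B y = OBDD.accept B (run (λ j s → OBDD.trans B j s (y j)) (OBDD.source B))

evalOBDD≡evalInOrder : ∀ (B : OBDD n w) x → evalOBDD B x ≡ evalInOrder B (x ∘ (OBDD.order B ⟨$⟩ʳ_))
evalOBDD≡evalInOrder B x = cong (OBDD.accept B)
  (foldl-tabulate (λ s j → OBDD.trans B j s (x (OBDD.order B ⟨$⟩ʳ j))) (λ j → j) (OBDD.source B))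

layers : NOBDD n w → (Fin n → Bool) → Fin n → Fin w → Fin w → Set
layers B y j u v = NOBDD.edge B j u (y j) v ≡ true

NAcceptsInOrder : NOBDD n w → (Fin n → Bool) → Set
NAcceptsInOrder B y = ∃ λ t → Reach (layers B y) (NOBDD.source B) t × NOBDD.accept B t ≡ true

NAccepts⇔NAcceptsInOrder : ∀ (B : NOBDD n w) x → NAccepts B x ⇔ NAcceptsInOrder B (x ∘ (NOBDD.order B ⟨$⟩ʳ_))
NAccepts⇔NAcceptsInOrder B x = mk⇔
  (λ (p , start , steps , accepting) →
     _ , Equivalence.from (Reach⇔Path _) (p , start , steps , refl) , accepting)
  (λ (t , reach , accepting) → case Equivalence.to (Reach⇔Path _) reach of λ where
     (p , start , steps , refl) → p , start , steps , accepting)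

Reach-layers-cong : ∀ {k} (B : NOBDD n w) {y y′ : Fin n → Bool} (g : Fin k → Fin n) →
  (∀ j → y (g j) ≡ y′ (g j)) → ∀ {s t} → Reach (layers B y ∘ g) s t → Reach (layers B y′ ∘ g) s t
Reach-layers-cong B g y≗y′ = Reach-map (λ j {u} {v} → subst (λ b → NOBDD.edge B (g j) u b v ≡ true) (y≗y′ j))

NAcceptsInOrder-cong : ∀ (B : NOBDD n w) {y y′} → (∀ j → y j ≡ y′ j) →
                       NAcceptsInOrder B y → NAcceptsInOrder B y′
NAcceptsInOrder-cong B y≗y′ (t , reach , accepting) = t , Reach-layers-cong B (λ j → j) y≗y′ reach , accepting

symmetric-NAcceptsInOrder : ∀ (F : ℕ → Bool) (B : NOBDD n w) →
  (∀ x → (F (weight x) ≡ true) ⇔ NAccepts B x) →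
  ∀ y → (F (weight y) ≡ true) ⇔ NAcceptsInOrder B y
symmetric-NAcceptsInOrder {n} F B computes y = mk⇔
  (λ Fy → NAcceptsInOrder-cong B read≗y
     (to (NAccepts⇔NAcceptsInOrder B x) (to (computes x) (subst (λ c → F c ≡ true) weight-y≡x Fy))))
  (λ acc → subst (λ c → F c ≡ true) (sym weight-y≡x)
     (from (computes x) (from (NAccepts⇔NAcceptsInOrder B x) (NAcceptsInOrder-cong B (sym ∘ read≗y) acc))))
  where
  open Equivalence
  π : Permutation′ n
  π = NOBDD.order B
  x : Fin n → Bool
  x = y ∘ (π ⟨$⟩ˡ_)
  read≗y : ∀ j → x (π ⟨$⟩ʳ j) ≡ y j
  read≗y j = cong y (inverseˡ π)
  weight-y≡x : weight y ≡ weight x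
  weight-y≡x = trans (sym (weight-cong read≗y)) (weight-permute π x)

project : ∀ {w w′} → Fin w → Fin w′ → Fin w
project {w} s₀ t with toℕ t <? w
... | yes t<w = fromℕ< t<w
... | no  _   = s₀

project-inject≤ : ∀ {w w′} (s₀ s : Fin w) (w≤w′ : w ≤ w′) → project s₀ (inject≤ s w≤w′) ≡ s
project-inject≤ {w} s₀ s w≤w′ with toℕ (inject≤ s w≤w′) <? w
... | yes t<w = toℕ-injective (trans (toℕ-fromℕ< t<w) (toℕ-inject≤ s w≤w′))
... | no  t≮w = contradiction (subst (_< w) (sym (toℕ-inject≤ s w≤w′)) (toℕ<n s)) t≮w

module _ {w w′} (w≤w′ : w ≤ w′) where

  widenOBDD : OBDD n w → OBDD n w′
  widenOBDD B = record
    { order  = order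
    ; source = inject≤ source w≤w′
    ; trans  = λ j s b → inject≤ (next j (project source s) b) w≤w′
    ; accept = accept ∘ project source
    }
    where open OBDD B renaming (trans to next)

  evalOBDD-widen : ∀ (B : OBDD n w) x → evalOBDD (widenOBDD B) x ≡ evalOBDD B x
  evalOBDD-widen {n} B x = begin
    evalOBDD (widenOBDD B) x                                  ≡⟨ evalOBDD≡evalInOrder (widenOBDD B) x ⟩
    accept (project source (run δ′ (inject≤ source w≤w′)))    ≡⟨ cong (accept ∘ project source) run-inject≤ ⟨
    accept (project source (inject≤ (run δ source) w≤w′))     ≡⟨ cong accept (project-inject≤ source _ w≤w′) ⟩
    accept (run δ source)                                     ≡⟨ evalOBDD≡evalInOrder B x ⟨
    evalOBDD B x                                              ∎
    where
    open OBDD B hiding (trans)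
    open ≡-Reasoning
    y : Fin n → Bool
    y = x ∘ (order ⟨$⟩ʳ_)
    δ : Fin n → Fin w → Fin w
    δ j s = OBDD.trans B j s (y j)
    δ′ : Fin n → Fin w′ → Fin w′
    δ′ j s = OBDD.trans (widenOBDD B) j s (y j)
    run-inject≤ : inject≤ (run δ source) w≤w′ ≡ run δ′ (inject≤ source w≤w′)
    run-inject≤ = run-natural (λ s → inject≤ s w≤w′)
      (λ j s → cong (λ u → inject≤ (OBDD.trans B j u (y j)) w≤w′) (sym (project-inject≤ source s w≤w′))) source

  widenNOBDD : NOBDD n w → NOBDD n w′
  widenNOBDD B = record
    { order  = order
    ; source = inject≤ source w≤w′
    ; edge   = λ j u b v → edge j (project source u) b (project source v)
    ; accept = accept ∘ project source
    }
    where open NOBDD B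

  NAccepts-widen : ∀ (B : NOBDD n w) x → NAccepts B x ⇔ NAccepts (widenNOBDD B) x
  NAccepts-widen B x = mk⇔
    (λ (p , start , steps , accepting) →
      ι ∘ p , cong ι start ,
      (λ j → subst₂ (λ u v → edge j u _ v ≡ true) (sym (retract _)) (sym (retract _)) (steps j)) ,
      subst (λ v → accept v ≡ true) (sym (retract _)) accepting)
    (λ (p , start , steps , accepting) →
      project source ∘ p , trans (cong (project source) start) (retract source) , steps , accepting)
    where
    open NOBDD B
    ι : Fin w → Fin w′
    ι s = inject≤ s w≤w′
    retract : ∀ s → project source (ι s) ≡ s
    retract s = project-inject≤ source s w≤w′

  InOBDD-mono : ∀ {f} → InOBDD n w f → InOBDD n w′ f
  InOBDD-mono (B , computes) = widenOBDD B , λ x → trans (evalOBDD-widen B x) (computes x)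

  InNOBDD-mono : ∀ {f} → InNOBDD n w f → InNOBDD n w′ f
  InNOBDD-mono (B , computes) = widenNOBDD B , λ x → NAccepts-widen B x ⇔-∘ computes x

encodeSet : ∀ {w} → (Fin w → Bool) → Fin (2 ^ w)
encodeSet S = funToFin (Inverse.from 2↔Bool ∘ S)

decodeSet : ∀ {w} → Fin (2 ^ w) → Fin w → Bool
decodeSet s = Inverse.to 2↔Bool ∘ finToFun s

decodeSet-encodeSet : ∀ {w} (S : Fin w → Bool) u → decodeSet (encodeSet S) u ≡ S u
decodeSet-encodeSet S u =
  trans (cong (Inverse.to 2↔Bool) (finToFun-funToFin _ u)) (Inverse.strictlyInverseˡ 2↔Bool (S u))

powerStep : ∀ {w} → (Fin w → Fin w → Bool) → Fin (2 ^ w) → Fin (2 ^ w)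
powerStep E s = encodeSet (λ v → anyᵇ (λ u → decodeSet s u ∧ E u v))

decodeSet-powerStep : ∀ {w} (E : Fin w → Fin w → Bool) s v →
  decodeSet (powerStep E s) v ≡ true ⇔ ∃ λ u → decodeSet s u ≡ true × E u v ≡ true
decodeSet-powerStep E s v = mk⇔
  (λ h → case to (anyᵇ⇔ _) (trans (sym (decodeSet-encodeSet _ v)) h) of λ where
    (u , su∧e) → u , to ∧⇔× su∧e)
  (λ (u , su , e) → trans (decodeSet-encodeSet _ v) (from (anyᵇ⇔ _) (u , from ∧⇔× (su , e))))
  where open Equivalence

decodeSet-run-powerStep : ∀ {m w} (E : Fin m → Fin w → Fin w → Bool) s v →
  decodeSet (run (powerStep ∘ E) s) v ≡ true ⇔
  ∃ λ u → decodeSet s u ≡ true × Reach (λ j u v → E j u v ≡ true) u v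
decodeSet-run-powerStep {zero}  E s v = mk⇔ (λ sv → v , sv , refl) λ where (u , su , refl) → su
decodeSet-run-powerStep {suc m} E s v = mk⇔
  (λ h → case to rest h of λ where
    (u′ , s′u′ , reach) → case to (decodeSet-powerStep (E zero) s u′) s′u′ of λ where
      (u , su , e) → u , su , u′ , e , reach)
  (λ (u , su , u′ , e , reach) → from rest (u′ , from (decodeSet-powerStep (E zero) s u′) (u , su , e) , reach))
  where
  open Equivalence
  rest : decodeSet (run (powerStep ∘ E ∘ suc) (powerStep (E zero) s)) v ≡ true ⇔
         ∃ λ u′ → decodeSet (powerStep (E zero) s) u′ ≡ true × Reach (λ j u v → E (suc j) u v ≡ true) u′ v
  rest = decodeSet-run-powerStep (E ∘ suc) (powerStep (E zero) s) v

decodeSet-singleton : ∀ {w} (s u : Fin w) → decodeSet (encodeSet (λ v → does (v ≟ s))) u ≡ true ⇔ u ≡ s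
decodeSet-singleton s u = subst (λ b → b ≡ true ⇔ u ≡ s) (sym (decodeSet-encodeSet _ u)) (does⇔ (u ≟ s))

module _ {w} (B : NOBDD n w) where
  open NOBDD B

  subsetOBDD : OBDD n (2 ^ w)
  subsetOBDD = record
    { order  = order
    ; source = encodeSet (λ u → does (u ≟ source))
    ; trans  = λ j s b → powerStep (λ u v → edge j u b v) s
    ; accept = λ s → anyᵇ (λ v → decodeSet s v ∧ accept v)
    }

  evalOBDD-subsetOBDD : ∀ x → NAccepts B x ⇔ evalOBDD subsetOBDD x ≡ true
  evalOBDD-subsetOBDD x = mk⇔
    (λ h → case to (NAccepts⇔NAcceptsInOrder B x) h of λ where
      (t , reach , accepting) → trans (evalOBDD≡evalInOrder subsetOBDD x) (from (anyᵇ⇔ _)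
        (t , from ∧⇔× (from (decodeSet-run-powerStep E _ t) (source , from (decodeSet-singleton source source) refl , reach) , accepting))))
    (λ h → case to (anyᵇ⇔ _) (trans (sym (evalOBDD≡evalInOrder subsetOBDD x)) h) of λ where
      (t , final∧accepting) → case to ∧⇔× final∧accepting of λ where
        (final , accepting) → case to (decodeSet-run-powerStep E _ t) final of λ where
          (u , initial , reach) → from (NAccepts⇔NAcceptsInOrder B x)
            (t , subst (λ u → Reach _ u t) (to (decodeSet-singleton source u) initial) reach , accepting))
    where
    open Equivalence
    E : Fin n → Fin w → Fin w → Bool
    E j u v = edge j u (x (order ⟨$⟩ʳ j)) v

InNOBDD⊆InOBDD-2^ : ∀ {w} → InNOBDD n w ⊆ᶜ InOBDD n (2 ^ w)
InNOBDD⊆InOBDD-2^ f (B , computes) =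
  subsetOBDD B , λ x → sym (Bool.⇔→≡ (evalOBDD-subsetOBDD B x ⇔-∘ computes x))

counterOBDD : ∀ {w} → (Fin w → Fin w) → Fin w → (Fin w → Bool) → OBDD n w
counterOBDD σ s₀ acc = record
  { order  = Perm.id
  ; source = s₀
  ; trans  = λ _ s b → if b then σ s else s
  ; accept = acc
  }

run-counter : ∀ (σ : A → A) (y : Fin n → Bool) s →
              run (λ j s → if y j then σ s else s) s ≡ iterate σ s (weight y)
run-counter {n = zero}  σ y s = refl
run-counter {n = suc n} σ y s with y zero
... | true  = run-counter σ (y ∘ suc) (σ s)
... | false = run-counter σ (y ∘ suc) s

evalOBDD-counter : ∀ {w} (σ : Fin w → Fin w) s₀ acc (x : Fin n → Bool) →
                   evalOBDD (counterOBDD σ s₀ acc) x ≡ acc (iterate σ s₀ (weight x))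
evalOBDD-counter σ s₀ acc x =
  trans (evalOBDD≡evalInOrder (counterOBDD σ s₀ acc) x) (cong acc (run-counter σ x s₀))

saturatingSuc : ∀ {k} → Fin (suc k) → Fin (suc k)
saturatingSuc {k} s = fromℕ< (s≤s (m⊓n≤n (suc (toℕ s)) k))

toℕ-iterate-saturatingSuc : ∀ {k} (s : Fin (suc k)) c → toℕ (iterate saturatingSuc s c) ≡ (toℕ s + c) ⊓ k
toℕ-iterate-saturatingSuc {k} s zero =
  sym (trans (cong (_⊓ k) (+-identityʳ (toℕ s))) (m≤n⇒m⊓n≡m (s≤s⁻¹ (toℕ<n s))))
toℕ-iterate-saturatingSuc {k} s (suc c) = begin
  toℕ (iterate saturatingSuc (saturatingSuc s) c)   ≡⟨ toℕ-iterate-saturatingSuc (saturatingSuc s) c ⟩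
  (toℕ (saturatingSuc s) + c) ⊓ k            ≡⟨ cong (λ t → (t + c) ⊓ k) (toℕ-fromℕ< _) ⟩
  (suc (toℕ s) ⊓ k + c) ⊓ k          ≡⟨ [m⊓o+n]⊓o≡[m+n]⊓o (suc (toℕ s)) c k ⟩
  (suc (toℕ s) + c) ⊓ k              ≡⟨ cong (_⊓ k) (+-suc (toℕ s) c) ⟨
  (toℕ s + suc c) ⊓ k                ∎
  where open ≡-Reasoning

cyclicSuc : ∀ {N} j .{{_ : NonZero j}} → j ≤ N → Fin N → Fin N
cyclicSuc j j≤N s = fromℕ< (<-≤-trans (m%n<n (suc (toℕ s)) j) j≤N)

toℕ-iterate-cyclicSuc : ∀ {N} j .{{_ : NonZero j}} (j≤N : j ≤ N) (s : Fin N) → toℕ s < j →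
                        ∀ c → toℕ (iterate (cyclicSuc j j≤N) s c) ≡ (toℕ s + c) % j
toℕ-iterate-cyclicSuc j j≤N s s<j zero    = sym (trans (cong (_% j) (+-identityʳ (toℕ s))) (m<n⇒m%n≡m s<j))
toℕ-iterate-cyclicSuc j j≤N s s<j (suc c) = begin
  toℕ (iterate (cyclicSuc j j≤N) (cyclicSuc j j≤N s) c)  ≡⟨ toℕ-iterate-cyclicSuc j j≤N _ next<j c ⟩
  (toℕ (cyclicSuc j j≤N s) + c) % j                      ≡⟨ cong (λ t → (t + c) % j) toℕ-next ⟩
  (suc (toℕ s) % j + c) % j                              ≡⟨ [m%n+o]%n≡[m+o]%n (suc (toℕ s)) j c ⟩
  (suc (toℕ s) + c) % j                                  ≡⟨ cong (_% j) (+-suc (toℕ s) c) ⟨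
  (toℕ s + suc c) % j                                    ∎
  where
  open ≡-Reasoning
  toℕ-next : toℕ (cyclicSuc j j≤N s) ≡ suc (toℕ s) % j
  toℕ-next = toℕ-fromℕ< _
  next<j : toℕ (cyclicSuc j j≤N s) < j
  next<j = subst (_< j) (sym toℕ-next) (m%n<n _ j)

asNOBDD : OBDD n w → NOBDD n w
asNOBDD B = record
  { order  = order
  ; source = source
  ; edge   = λ j u b v → does (v ≟ next j u b)
  ; accept = accept
  }
  where open OBDD B renaming (trans to next)

Reach-graphᵇ : ∀ (H : Fin n → Fin w → Fin w) {s t} →
               Reach (λ j u v → does (v ≟ H j u) ≡ true) s t ⇔ t ≡ run H s
Reach-graphᵇ H = mk⇔ (to (Reach-graph H) ∘ Reach-map (λ j {u} {v} → to (does⇔ (v ≟ H j u))))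
                     (Reach-map (λ j {u} {v} → from (does⇔ (v ≟ H j u))) ∘ from (Reach-graph H))
  where open Equivalence

NAccepts-asNOBDD : ∀ (B : OBDD n w) x → evalOBDD B x ≡ true ⇔ NAccepts (asNOBDD B) x
NAccepts-asNOBDD {n} {w} B x = mk⇔
  (λ accepting → from (NAccepts⇔NAcceptsInOrder (asNOBDD B) x)
    (_ , from (Reach-graphᵇ δ) refl , trans (sym (evalOBDD≡evalInOrder B x)) accepting))
  (λ h → case to (NAccepts⇔NAcceptsInOrder (asNOBDD B) x) h of λ where
    (t , reach , accepting) → trans (evalOBDD≡evalInOrder B x)
      (subst (λ t → OBDD.accept B t ≡ true) (to (Reach-graphᵇ δ) reach) accepting))
  where
  open Equivalence
  δ : Fin n → Fin w → Fin w
  δ j s = OBDD.trans B j s (x (OBDD.order B ⟨$⟩ʳ j))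

-- Node combine i u of the union stands for node u of D i; the first edge guesses i.
module _ {N w} (π : Permutation′ (suc n)) (D : Fin (suc N) → OBDD (suc n) w) where

  unionStep : Fin (suc n) → Fin (suc N * w) → Bool → Fin (suc N * w)
  unionStep j s b = uncurry (λ i u → combine i (OBDD.trans (D i) j u b)) (remQuot {suc N} w s)

  unionAccept : Fin (suc N * w) → Bool
  unionAccept s = uncurry (λ i u → OBDD.accept (D i) u) (remQuot {suc N} w s)

  unionNOBDD : NOBDD (suc n) (suc N * w)
  unionNOBDD = record
    { order  = π
    ; source = combine {suc N} zero (OBDD.source (D zero))
    ; edge   = λ where
        zero    _ b v → anyᵇ (λ i → does (v ≟ combine i (OBDD.trans (D i) zero (OBDD.source (D i)) b)))
        (suc j) u b v → does (v ≟ unionStep (suc j) u b)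
    ; accept = unionAccept
    }

  NAccepts-unionNOBDD : ∀ x → (∃ λ i → evalInOrder (D i) (x ∘ (π ⟨$⟩ʳ_)) ≡ true) ⇔ NAccepts unionNOBDD x
  NAccepts-unionNOBDD x = mk⇔
    (λ (i , accepting) → from (NAccepts⇔NAcceptsInOrder unionNOBDD x)
      ( _
      , (combine i (start i) , from (anyᵇ⇔ (guess (combine i (start i)))) (i , from (does⇔ (combine i (start i) ≟ _)) refl)
                             , from (Reach-graphᵇ H) refl)
      , trans (cong unionAccept (run-combine i _)) (trans (accept-combine i _) accepting)))
    (λ h → case to (NAccepts⇔NAcceptsInOrder unionNOBDD x) h of λ where
      (t , (u , guessed , reach) , accepting) → case to (anyᵇ⇔ _) guessed of λ where
        (i , u≟) → i , (begin
          evalInOrder (D i) y                                  ≡⟨ accept-combine i _ ⟨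
          unionAccept (combine i (run (δ i ∘ suc) (start i)))  ≡⟨ cong unionAccept (run-combine i _) ⟨
          unionAccept (run H (combine i (start i)))            ≡⟨ cong (unionAccept ∘ run H) (to (does⇔ (_ ≟ _)) u≟) ⟨
          unionAccept (run H u)                                ≡⟨ cong unionAccept (to (Reach-graphᵇ H) reach) ⟨
          unionAccept t                                        ≡⟨ accepting ⟩
          true                                                 ∎))
    where
    open Equivalence
    open ≡-Reasoning
    y : Fin (suc n) → Bool
    y = x ∘ (π ⟨$⟩ʳ_)
    δ : Fin (suc N) → Fin (suc n) → Fin w → Fin w
    δ i j s = OBDD.trans (D i) j s (y j)
    start : Fin (suc N) → Fin w
    start i = δ i zero (OBDD.source (D i))
    guess : Fin (suc N * w) → Fin (suc N) → Bool
    guess v i = does (v ≟ combine i (start i))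
    H : Fin n → Fin (suc N * w) → Fin (suc N * w)
    H j s = unionStep (suc j) s (y (suc j))
    run-combine : ∀ i s → run H (combine i s) ≡ combine i (run (δ i ∘ suc) s)
    run-combine i s = sym (run-natural (combine i)
      (λ j s → sym (cong (uncurry (λ i u → combine i (δ i (suc j) u))) (remQuot-combine i s))) s)
    accept-combine : ∀ i s → unionAccept (combine i s) ≡ OBDD.accept (D i) s
    accept-combine i s = cong (uncurry (λ i u → OBDD.accept (D i) u)) (remQuot-combine i s)

-- Fooling sets

-- Otherwise two of the K + 1 accepting paths meet after the prefix, and the crossed
-- input u i ++ v j is accepted.
fooling-set : ∀ {k m w K} (B : NOBDD (k + m) w)
  (u : Fin (suc K) → Fin k → Bool) (v : Fin (suc K) → Fin m → Bool) →
  (∀ i → NAcceptsInOrder B (u i ++ v i)) →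
  (∀ {i j} → toℕ i < toℕ j → ¬ NAcceptsInOrder B (u i ++ v j)) →
  K < w
fooling-set {k} {m} {w} {K} B u v accepts rejects with K <? w
... | yes K<w = K<w
... | no  K≮w = ⊥-elim (collision (pigeonhole (s≤s (≮⇒≥ K≮w)) middle))
  where
  Suffix : Fin (suc K) → Fin w → Set
  Suffix i s = ∃ λ t → Reach (layers B (u i ++ v i) ∘ (k ↑ʳ_)) s t × NOBDD.accept B t ≡ true
  midpoint : ∀ i → ∃ λ s → Reach (layers B (u i ++ v i) ∘ (_↑ˡ m)) (NOBDD.source B) s × Suffix i s
  midpoint i with accepts i
  ... | t , reach , acc with Reach-split k _ reach
  ...   | s , front , back = s , front , t , back , acc
  middle : Fin (suc K) → Fin w
  middle i = proj₁ (midpoint i)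
  prefix-agrees : ∀ i j l → (u i ++ v i) (l ↑ˡ m) ≡ (u i ++ v j) (l ↑ˡ m)
  prefix-agrees i j l = trans (lookup-++ˡ (u i) (v i) l) (sym (lookup-++ˡ (u i) (v j) l))
  suffix-agrees : ∀ i j l → (u j ++ v j) (k ↑ʳ l) ≡ (u i ++ v j) (k ↑ʳ l)
  suffix-agrees i j l = trans (lookup-++ʳ (u j) (v j) l) (sym (lookup-++ʳ (u i) (v j) l))
  crossing : ∀ i j → middle i ≡ middle j → NAcceptsInOrder B (u i ++ v j)
  crossing i j same-middle with subst (Suffix j) (sym same-middle) (proj₂ (proj₂ (midpoint j)))
  ... | t , back , acc =
    t , Reach-join k (layers B (u i ++ v j))
          (Reach-layers-cong B {u i ++ v i} {u i ++ v j} (_↑ˡ m) (prefix-agrees i j) (proj₁ (proj₂ (midpoint i))))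
          (Reach-layers-cong B {u j ++ v j} {u i ++ v j} (k ↑ʳ_) (suffix-agrees i j) back)
      , acc
  collision : ¬ ∃ λ i → ∃ λ j → toℕ i < toℕ j × middle i ≡ middle j
  collision (i , j , i<j , same-middle) = rejects i<j (crossing i j same-middle)

-- 1^i 0^(k-i) | 1^(k-j) 0^(m-k+j) is a fooling set.
symmetric-NOBDD-width : ∀ {n w k} (F : ℕ → Bool) (B : NOBDD n w) →
  (∀ x → (F (weight x) ≡ true) ⇔ NAccepts B x) → k + k ≤ n →
  F k ≡ true → (∀ {a b} → a < b → b ≤ k → F (a + (k ∸ b)) ≡ false) → k < w
symmetric-NOBDD-width {k = k} F B computes 2k≤n Fk F-below with m≤n⇒∃[o]m+o≡n (≤-trans (m≤m+n k k) 2k≤n)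
... | m , refl = fooling-set {k} {m} B (λ i → ones (toℕ i)) (λ j → ones (k ∸ toℕ j)) accepts rejects
  where
  open Equivalence
  input : Fin (suc k) → Fin (suc k) → Fin (k + m) → Bool
  input i j = ones {k} (toℕ i) ++ ones {m} (k ∸ toℕ j)
  ≤k : ∀ (i : Fin (suc k)) → toℕ i ≤ k
  ≤k i = s≤s⁻¹ (toℕ<n i)
  weight-input : ∀ i j → weight (input i j) ≡ toℕ i + (k ∸ toℕ j)
  weight-input i j = trans (weight-++ (ones {k} (toℕ i)) (ones {m} (k ∸ toℕ j)))
    (cong₂ _+_ (weight-ones (toℕ i) (≤k i)) (weight-ones (k ∸ toℕ j) (≤-trans (m∸n≤m k (toℕ j)) k≤m)))
    where
    k≤m : k ≤ m
    k≤m = +-cancelˡ-≤ k k m 2k≤n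
  accepted : ∀ y → F (weight y) ≡ true ⇔ NAcceptsInOrder B y
  accepted = symmetric-NAcceptsInOrder F B computes
  accepts : ∀ i → NAcceptsInOrder B (input i i)
  accepts i = to (accepted (input i i))
    (subst (λ c → F c ≡ true) (sym (trans (weight-input i i) (m+[n∸m]≡n (≤k i)))) Fk)
  rejects : ∀ {i j} → toℕ i < toℕ j → ¬ NAcceptsInOrder B (input i j)
  rejects {i} {j} i<j accepting with
    trans (sym (F-below i<j (≤k j))) (subst (λ c → F c ≡ true) (weight-input i j) (from (accepted (input i j)) accepting))
  ... | ()

symmetric-OBDD-width : ∀ {n w k} (F : ℕ → Bool) (B : OBDD n w) →
  (∀ x → evalOBDD B x ≡ F (weight x)) → k + k ≤ n →
  (∀ {a b} → a < b → b ≤ k → F (a + (k ∸ b)) ≢ F k) → k < w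
symmetric-OBDD-width {n} {w} {k} F B computes 2k≤n F-below =
  symmetric-NOBDD-width agrees (asNOBDD agreesOBDD) computes′ 2k≤n
    (dec-true (F k Bool.≟ F k) refl) (λ a<b b≤k → dec-false (_ Bool.≟ F k) (F-below a<b b≤k))
  where
  agrees : ℕ → Bool
  agrees c = does (F c Bool.≟ F k)
  agreesOBDD : OBDD n w
  agreesOBDD = record B { accept = λ s → does (OBDD.accept B s Bool.≟ F k) }
  computes′ : ∀ x → (agrees (weight x) ≡ true) ⇔ NAccepts (asNOBDD agreesOBDD) x
  computes′ x = subst (λ b → does (b Bool.≟ F k) ≡ true ⇔ NAccepts (asNOBDD agreesOBDD) x) (computes x)
    (NAccepts-asNOBDD agreesOBDD x)

-- The separating functions

threshold : ℕ → BoolFun n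
threshold k x = does (k ≤? weight x)

threshold∈OBDD : ∀ k → InOBDD n (suc k) (threshold k)
threshold∈OBDD k = counterOBDD saturatingSuc zero reached , λ x → begin
  evalOBDD (counterOBDD saturatingSuc zero reached) x
    ≡⟨ evalOBDD-counter saturatingSuc zero reached x ⟩
  reached (iterate saturatingSuc zero (weight x))
    ≡⟨ cong (λ c → does (k ≤? c)) (toℕ-iterate-saturatingSuc zero (weight x)) ⟩
  does (k ≤? weight x ⊓ k)
    ≡⟨ does-⇔ k≤c⊓k⇔k≤c (k ≤? weight x ⊓ k) (k ≤? weight x) ⟩
  threshold k x
    ∎
  where
  open ≡-Reasoning
  reached : Fin (suc k) → Bool
  reached s = does (k ≤? toℕ s)
  k≤c⊓k⇔k≤c : ∀ {c} → k ≤ c ⊓ k ⇔ k ≤ c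
  k≤c⊓k⇔k≤c = mk⇔ (λ k≤c⊓k → ≤-trans k≤c⊓k (m⊓n≤m _ k)) (λ k≤c → ⊓-glb k≤c ≤-refl)

threshold-NOBDD-width : ∀ {n w} k → k + k ≤ n → InNOBDD n w (threshold k) → k < w
threshold-NOBDD-width k 2k≤n (B , computes) =
  symmetric-NOBDD-width (λ c → does (k ≤? c)) B computes 2k≤n (dec-true (k ≤? k) ≤-refl)
    (λ a<b b≤k → dec-false (k ≤? _) (<⇒≱ (m<n≤o⇒m+[o∸n]<o a<b b≤k)))

incongruent? : ∀ c d j → Dec (c % suc j ≢ d % suc j)
incongruent? c d j = ¬? (c % suc j ℕ.≟ d % suc j)

-- i : Fin N stands for the modulus i + 1.
IncongruentUpTo : ℕ → ℕ → ℕ → Set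
IncongruentUpTo N c d = ∃ λ (i : Fin N) → c % suc (toℕ i) ≢ d % suc (toℕ i)

incongruentUpTo? : ∀ N c d → Dec (IncongruentUpTo N c d)
incongruentUpTo? N c d = any? λ i → incongruent? c d (toℕ i)

modTest : ℕ → ℕ → BoolFun n
modTest N d x = does (incongruentUpTo? N (weight x) d)

modTest∈NOBDD : ∀ N d → InNOBDD (suc n) (suc N * suc N) (modTest (suc N) d)
modTest∈NOBDD {n} N d = unionNOBDD Perm.id counter , λ x →
  NAccepts-unionNOBDD Perm.id counter x ⇔-∘ (counter-accepts x ⇔-∘ does⇔ (incongruentUpTo? (suc N) (weight x) d))
  where
  open Equivalence
  differs : Fin (suc N) → Fin (suc N) → Bool
  differs i s = does (¬? (toℕ s ℕ.≟ d % suc (toℕ i)))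
  counter : Fin (suc N) → OBDD (suc n) (suc N)
  counter i = counterOBDD (cyclicSuc (suc (toℕ i)) (toℕ<n i)) zero (differs i)
  evalInOrder-counter : ∀ x i → evalInOrder (counter i) x ≡ does (incongruent? (weight x) d (toℕ i))
  evalInOrder-counter x i = begin
    evalInOrder (counter i) x                    ≡⟨ evalOBDD≡evalInOrder (counter i) x ⟨
    evalOBDD (counter i) x                       ≡⟨ evalOBDD-counter _ zero (differs i) x ⟩
    differs i (iterate (cyclicSuc (suc (toℕ i)) (toℕ<n i)) zero (weight x))
      ≡⟨ cong (λ r → does (¬? (r ℕ.≟ d % suc (toℕ i))))
              (toℕ-iterate-cyclicSuc (suc (toℕ i)) (toℕ<n i) zero (s≤s z≤n) (weight x)) ⟩
    does (incongruent? (weight x) d (toℕ i))     ∎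
    where open ≡-Reasoning
  counter-accepts : ∀ x → IncongruentUpTo (suc N) (weight x) d ⇔ ∃ λ i → evalInOrder (counter i) x ≡ true
  counter-accepts x = mk⇔
    (λ (i , ≢) → i , trans (evalInOrder-counter x i) (from (does⇔ (incongruent? (weight x) d (toℕ i))) ≢))
    (λ (i , accepting) → i , to (does⇔ (incongruent? (weight x) d (toℕ i)))
                                 (trans (sym (evalInOrder-counter x i)) accepting))

-- If a + (d - b) ≡ d modulo every j ≤ 2m + 1 then every such j divides b - a, so
-- b - a ≥ 2^m > d: impossible.
modTest-OBDD-width : ∀ {n w} m d → d < 2 ^ m → d + d ≤ n → InOBDD n w (modTest (suc (m + m)) d) → d < w
modTest-OBDD-width m d d<2^m 2d≤n (B , computes) =
  symmetric-OBDD-width F B computes 2d≤n separates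
  where
  N : ℕ
  N = suc (m + m)
  F : ℕ → Bool
  F c = does (incongruentUpTo? N c d)
  separates : ∀ {a b} → a < b → b ≤ d → F (a + (d ∸ b)) ≢ F d
  separates {a} {b} a<b b≤d same = <⇒≱ d<2^m (begin
    2 ^ m    ≤⟨ 2^m≤common-multiple m {{>-nonZero (m<n⇒0<n∸m a<b)}} divisors ⟩
    b ∸ a    ≤⟨ m∸n≤m b a ⟩
    b        ≤⟨ b≤d ⟩
    d        ∎)
    where
    open ≤-Reasoning
    open Equivalence
    c : ℕ
    c = a + (d ∸ b)
    congruent : ¬ IncongruentUpTo N c d
    congruent incongruent with to (does⇔ (incongruentUpTo? N d d))
                                  (trans (sym same) (from (does⇔ (incongruentUpTo? N c d)) incongruent))
    ... | _ , d≢d = d≢d refl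
    congruent-at : ∀ j → j < N → c % suc j ≡ d % suc j
    congruent-at j j<N = decidable-stable (c % suc j ℕ.≟ d % suc j) λ c≢d →
      congruent (fromℕ< j<N , subst (λ t → c % suc t ≢ d % suc t) (sym (toℕ-fromℕ< j<N)) c≢d)
    divisors : ∀ j → j < N → suc j ∣ b ∸ a
    divisors j j<N = m%n≡[m+o]%n⇒n∣o c (suc j) (b ∸ a)
      (trans (congruent-at j j<N) (cong (_% suc j) (sym (m+[o∸n]+[n∸m]≡o (<⇒≤ a<b) b≤d))))

g : ℕ → ℕ
g d = suc (m + m) * suc (m + m)
  where
  m : ℕ
  m = suc ⌊log₂ d ⌋

[2L+3]²≤25L² : ∀ L → 1 ≤ L → suc (suc L + suc L) * suc (suc L + suc L) ≤ 25 * (L * L)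
[2L+3]²≤25L² L 1≤L = begin
  suc (suc L + suc L) * suc (suc L + suc L)  ≤⟨ *-mono-≤ 2L+3≤5L 2L+3≤5L ⟩
  5 * L * (5 * L)                            ≡⟨ solve (L ∷ []) ⟩
  25 * (L * L)                               ∎
  where
  open ≤-Reasoning
  2L+3≤5L : suc (suc L + suc L) ≤ 5 * L
  2L+3≤5L = begin
    suc (suc L + suc L) ≡⟨ cong (2 +_) (+-suc L L) ⟩
    3 + (L + L)         ≤⟨ +-monoˡ-≤ (L + L) (*-monoʳ-≤ 3 1≤L) ⟩
    3 * L + (L + L)     ≡⟨ solve (L ∷ []) ⟩
    5 * L               ∎

g-isBigO : IsBigOLog2LogLog g
g-isBigO = 25 , 4 , λ d 4≤d → bound ⌊log₂ d ⌋ (⌊log₂⌋-mono-≤ 4≤d)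
  where
  bound : ∀ L → 2 ≤ L → suc (suc L + suc L) * suc (suc L + suc L) ≤ 25 * (L * L * ⌊log₂ L ⌋)
  bound L 2≤L = begin
    suc (suc L + suc L) * suc (suc L + suc L)  ≤⟨ [2L+3]²≤25L² L (≤-trans (s≤s z≤n) 2≤L) ⟩
    25 * (L * L)                               ≡⟨ cong (25 *_) (*-identityʳ (L * L)) ⟨
    25 * (L * L * 1)                           ≤⟨ *-monoʳ-≤ 25 (*-monoʳ-≤ (L * L) (⌊log₂⌋-mono-≤ 2≤L)) ⟩
    25 * (L * L * ⌊log₂ L ⌋)                   ∎
    where open ≤-Reasoning

theorem8 : Σ (ℕ → ℕ) λ g → IsBigOLog2LogLog g ×
    ((n d d′ : ℕ) → d * 2 ≤ n → g d < d′ → d′ ≤ d ∸ 1 →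
    (InNOBDD n ⌊log₂ d ⌋ ⊊ᶜ InOBDD n d) × Incomparable (InOBDD n d) (InNOBDD n d′))
theorem8 = g , g-isBigO , separations
  where
  separations : (n d d′ : ℕ) → d * 2 ≤ n → g d < d′ → d′ ≤ d ∸ 1 →
    (InNOBDD n ⌊log₂ d ⌋ ⊊ᶜ InOBDD n d) × Incomparable (InOBDD n d) (InNOBDD n d′)
  separations n       zero    d′ _  g<d′ d′≤0 = contradiction (≤-trans g<d′ d′≤0) λ ()
  separations zero    (suc k) d′ () _    _
  separations (suc n) (suc k) d′ 2d≤n g<d′ d′≤k =
    ( (λ f → InOBDD-mono 2^L≤d ∘ InNOBDD⊆InOBDD-2^ f)
    , threshold k , threshold∈OBDD k , λ in-L → <⇒≱ (threshold-NOBDD-width k 2k≤n in-L) L≤k )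
    , ( threshold k , threshold∈OBDD k , λ in-d′ → <⇒≱ (threshold-NOBDD-width k 2k≤n in-d′) d′≤k )
    , ( modTest (suc (m + m)) d , InNOBDD-mono (<⇒≤ g<d′) (modTest∈NOBDD (m + m) d)
      , λ in-d → <-irrefl refl (modTest-OBDD-width m d (n<2^[1+⌊log₂n⌋] d) 2d≤n′ in-d) )
    where
    d m : ℕ
    d = suc k
    m = suc ⌊log₂ d ⌋
    2^L≤d : 2 ^ ⌊log₂ d ⌋ ≤ d
    2^L≤d = 2^⌊log₂n⌋≤n d
    L≤k : ⌊log₂ d ⌋ ≤ k
    L≤k = s≤s⁻¹ (<-≤-trans (n<2^n ⌊log₂ d ⌋) 2^L≤d)
    2d≤n′ : d + d ≤ suc n
    2d≤n′ = subst (_≤ suc n) (n*2≡n+n d) 2d≤n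
    2k≤n : k + k ≤ suc n
    2k≤n = ≤-trans (+-mono-≤ (n≤1+n k) (n≤1+n k)) 2d≤n′
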